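{- Let $r_1,x_1$ be positive integers and let $\mathbf{q}=(r_1,r_1,\ldots,r_1)\in\mathbb{Z}_{\geq1}^{x_1}$ (the entry $r_1$ repeated $x_1$ times). If $\Delta_{(1,\mathbf{q})}$ is reflexive and IDP, then $\mathbf{q}=(1,1,\ldots,1)$, i.e. $r_1=1$.
   Context: For $\mathbf{q}=(q_1,\ldots,q_n)\in\mathbb{Z}_{\geq1}^n$, $\Delta_{(1,\mathbf{q})}:=\mathrm{conv}\{\mathbf{e}_1,\ldots,\mathbf{e}_n,-\sum_{i=1}^n q_i\mathbf{e}_i\}\subset\mathbb{R}^n$. For a lattice polytope $P\subset\mathbb{R}^n$, $\mathrm{cone}(P)$ is the nonnegative real span of the vectors $(1,\mathbf{v})$, $\mathbf{v}$ a vertex of $P$. $P$ is IDP if for every positive integer $m$ and every $(m,\mathbf{w})\in\mathrm{cone}(P)\cap\mathbb{Z}^{n+1}$ there exist $\mathbf{x}_1,\ldots,\mathbf{x}_m\in P\cap\mathbb{Z}^n$ with $(m,\mathbf{w})=\sum_i(1,\mathbf{x}_i)$. $P$ is reflexive if, after an integer translation, the origin is in the interior of $P$ and the polar dual of $P$ is a lattice polytope. -}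

module Defs where

open import Data.Nat as ℕ using (ℕ; zero; suc)
open import Data.Integer as ℤ using (ℤ)
open import Data.Rational as ℚ using (ℚ; 0ℚ; 1ℚ)
open import Data.Fin using (Fin; zero; suc)
open import Data.Product using (Σ; ∃; _×_)
open import Relation.Binary.PropositionalEquality using (_≡_)
open import Relation.Nullary using (Dec; yes; no)
open import Data.Fin using (_≟_)
open import Function.Bundles using (_⇔_)

Pointℚ : ℕ → Set
Pointℚ n = Fin n → ℚ

Pointℤ : ℕ → Set
Pointℤ n = Fin n → ℤ

ℤ→ℚ : ℤ → ℚ
ℤ→ℚ z = z ℚ./ 1

embed : ∀ {n} → Pointℤ n → Pointℚ n
embed x i = ℤ→ℚ (x i)

sumℚ : ∀ {k} → (Fin k → ℚ) → ℚ
sumℚ {zero}  f = 0ℚ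
sumℚ {suc k} f = f zero ℚ.+ sumℚ (λ j → f (suc j))

sumℤ : ∀ {k} → (Fin k → ℤ) → ℤ
sumℤ {zero}  f = ℤ.+ 0
sumℤ {suc k} f = f zero ℤ.+ sumℤ (λ j → f (suc j))

dot : ∀ {n} → Pointℚ n → Pointℚ n → ℚ
dot x y = sumℚ (λ i → x i ℚ.* y i)

-- A (lattice) polytope is presented by a finite list of lattice points
-- V : Fin k → Pointℤ n (its vertices, or any generating set).

InConv : ∀ {k n} → (Fin k → Pointℤ n) → Pointℚ n → Set
InConv {k} V x =
  Σ (Fin k → ℚ) λ c →
    (∀ j → 0ℚ ℚ.≤ c j) × (sumℚ c ≡ 1ℚ) ×
    (∀ i → sumℚ (λ j → c j ℚ.* ℤ→ℚ (V j i)) ≡ x i)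

-- (m , w) lies in cone(P) = nonnegative span of the vectors (1 , Vⱼ).
InCone : ∀ {k n} → (Fin k → Pointℤ n) → ℚ → Pointℚ n → Set
InCone {k} V m w =
  Σ (Fin k → ℚ) λ c →
    (∀ j → 0ℚ ℚ.≤ c j) × (sumℚ c ≡ m) ×
    (∀ i → sumℚ (λ j → c j ℚ.* ℤ→ℚ (V j i)) ≡ w i)

IsIDP : ∀ {k n} → (Fin k → Pointℤ n) → Set
IsIDP {k} {n} V =
  (m : ℕ) → 1 ℕ.≤ m → (w : Pointℤ n) →
  InCone V (ℤ→ℚ (ℤ.+ m)) (embed w) →
  Σ (Fin m → Pointℤ n) λ xs →
    (∀ i → InConv V (embed (xs i))) × (∀ c → sumℤ (λ i → xs i c) ≡ w c)

translate : ∀ {k n} → (Fin k → Pointℤ n) → Pointℤ n → (Fin k → Pointℤ n)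
translate V t j i = V j i ℤ.- t i

scale : ∀ {n} → ℚ → Pointℚ n → Pointℚ n
scale ε d i = ε ℚ.* d i

OriginInInterior : ∀ {k n} → (Fin k → Pointℤ n) → Set
OriginInInterior {k} {n} V =
  (d : Pointℚ n) → Σ ℚ λ ε → (0ℚ ℚ.< ε) × InConv V (scale ε d)

InPolarDual : ∀ {k n} → (Fin k → Pointℤ n) → Pointℚ n → Set
InPolarDual {k} {n} V y = (x : Pointℚ n) → InConv V x → dot x y ℚ.≤ 1ℚ

IsLatticePolytope : ∀ {n} → (Pointℚ n → Set) → Set
IsLatticePolytope {n} S =
  Σ ℕ λ l → Σ (Fin l → Pointℤ n) λ U → (y : Pointℚ n) → S y ⇔ InConv U y

IsReflexive : ∀ {k n} → (Fin k → Pointℤ n) → Set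
IsReflexive {k} {n} V =
  Σ (Pointℤ n) λ t →
    OriginInInterior (translate V t) ×
    IsLatticePolytope (InPolarDual (translate V t))

unitVec : ∀ {n} → Fin n → Pointℤ n
unitVec i j with i ≟ j
... | yes _ = ℤ.+ 1
... | no _  = ℤ.+ 0

-- vertices of Δ_(1,q) = conv{e₁,…,eₙ, -Σ qᵢ eᵢ}
simplexVerts : ∀ {n} → (Fin n → ℕ) → (Fin (suc n) → Pointℤ n)
simplexVerts q zero    i = ℤ.- (ℤ.+ q i)
simplexVerts q (suc j) i = unitVec j i

-- Reflexivity alone forces r = 1.  Let W be the
-- vertices translated by the integer vector t that puts the origin in the interior,
-- and s = Σ tₗ.  Moving from the origin along (1,…,1) stays inside conv W only if
-- s ≤ 0.  A linear bound that holds at the lattice points of a lattice polytope holds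
-- on all of it, and the dual polytope of conv W violates such a bound:
--  * if s < 0, the dual vertex y = (1,…,1)/(1 - s) gives Σᵢ ⟨W (suc i), y⟩ = n, while a
--    lattice point u with all ⟨W (suc i), u⟩ = 1 would satisfy (1 + ⟨t,u⟩)(1 - s) = 1;
--  * if s = 0, moving along -(1,…,1) shows t ≥ 0, so t = 0; then ⟨W zero, u⟩ = -r Σ uₗ
--    is a multiple of r ≥ 2 at lattice points, but equals 1 at the dual point -eᵢ/r.
module Submission where

open import Algebra.Bundles using (Ring)
open import Data.Empty using (⊥; ⊥-elim)
open import Data.Fin using (Fin; zero; suc; _≟_)
open import Data.Integer as ℤ using (ℤ; -[1+_]; +[1+_])
import Data.Integer.Properties as ℤP
open import Data.Nat as ℕ using (ℕ; zero; suc)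
open import Data.Nat.Coprimality using (1-coprimeTo) renaming (sym to coprime-sym)
import Data.Nat.Properties as ℕP
open import Data.Product using (_,_)
open import Data.Rational as ℚ using (ℚ; mkℚ; 0ℚ; 1ℚ; *≤*; *<*; _+_; _*_; _-_; -_; _≤_; _<_)
import Data.Rational.Properties as ℚP
open import Data.Rational.Unnormalised as ℚᵘ using (mkℚᵘ; *≡*)
import Data.Rational.Unnormalised.Properties as ℚᵘP
open import Function.Bundles using (Equivalence)
open import Level using (0ℓ)
open import Relation.Binary.PropositionalEquality
open import Relation.Nullary using (¬_; yes; no)
open import Relation.Nullary.Decidable.Core using (dec⇒maybe)
open import Tactic.RingSolver using (solve-∀)
open import Tactic.RingSolver.Core.AlmostCommutativeRing using (AlmostCommutativeRing; fromCommutativeRing)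

open import Algebra.Properties.Group ℚP.+-0-group using (x∙y⁻¹≈ε⇒x≈y)
open import Algebra.Properties.Semiring.Sum (Ring.semiring ℚP.+-*-ring)
  using (sum; sum-cong-≗; ∑-distrib-+; ∑-comm; *-distribˡ-sum; *-distribʳ-sum; sum-replicate-zero)
open import Defs

ℚ-ring : AlmostCommutativeRing 0ℓ 0ℓ
ℚ-ring = fromCommutativeRing ℚP.+-*-commutativeRing (λ x → dec⇒maybe (0ℚ ℚP.≟ x))

p+[q-p]≡q : ∀ p q → p + (q - p) ≡ q
p+[q-p]≡q = solve-∀ ℚ-ring

p≡q-r⇒r≡q-p : ∀ {p q r} → p ≡ q - r → r ≡ q - p
p≡q-r⇒r≡q-p {q = q} {r} refl = r≡q-[q-r] q r
  where
  r≡q-[q-r] : ∀ q r → r ≡ q - (q - r)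
  r≡q-[q-r] = solve-∀ ℚ-ring

p≡q-r⇒q≡p+r : ∀ {p q r} → p ≡ q - r → q ≡ p + r
p≡q-r⇒q≡p+r {q = q} {r} refl = q≡[q-r]+r q r
  where
  q≡[q-r]+r : ∀ q r → q ≡ (q - r) + r
  q≡[q-r]+r = solve-∀ ℚ-ring

p≤q⇒0≤q-p : ∀ {p q} → p ≤ q → 0ℚ ≤ q - p
p≤q⇒0≤q-p {p} {q} p≤q = subst (_≤ q - p) (ℚP.+-inverseʳ p) (ℚP.+-monoˡ-≤ (- p) p≤q)

0≤q-p⇒p≤q : ∀ {p q} → 0ℚ ≤ q - p → p ≤ q
0≤q-p⇒p≤q {p} {q} 0≤q-p =
  subst₂ _≤_ (ℚP.+-identityʳ p) (p+[q-p]≡q p q) (ℚP.+-monoʳ-≤ p 0≤q-p)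

0<q-p⇒p<q : ∀ {p q} → 0ℚ < q - p → p < q
0<q-p⇒p<q {p} {q} 0<q-p =
  subst₂ _<_ (ℚP.+-identityʳ p) (p+[q-p]≡q p q) (ℚP.+-monoʳ-< p 0<q-p)

*-nonNeg : ∀ {p q} → 0ℚ ≤ p → 0ℚ ≤ q → 0ℚ ≤ p * q
*-nonNeg {p} {q} 0≤p 0≤q = ℚP.nonNegative⁻¹ (p * q)
  {{ℚP.nonNeg*nonNeg⇒nonNeg p {{ℚ.nonNegative 0≤p}} q {{ℚ.nonNegative 0≤q}}}}

*-pos : ∀ {p q} → 0ℚ < p → 0ℚ < q → 0ℚ < p * q
*-pos {p} {q} 0<p 0<q = ℚP.positive⁻¹ (p * q)
  {{ℚP.pos*pos⇒pos p {{ℚ.positive 0<p}} q {{ℚ.positive 0<q}}}}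

ℤ→ℚ≡mkℚ : ∀ z → ℤ→ℚ z ≡ mkℚ z 0 (coprime-sym (1-coprimeTo ℤ.∣ z ∣))
ℤ→ℚ≡mkℚ z = ℚP.↥p/↧p≡p (mkℚ z 0 _)

toℚᵘ-ℤ→ℚ : ∀ z → ℚ.toℚᵘ (ℤ→ℚ z) ℚᵘ.≃ mkℚᵘ z 0
toℚᵘ-ℤ→ℚ z = ℚP.toℚᵘ-cong (ℤ→ℚ≡mkℚ z)

ℤ→ℚ-homo-+ : ∀ a b → ℤ→ℚ (a ℤ.+ b) ≡ ℤ→ℚ a + ℤ→ℚ b
ℤ→ℚ-homo-+ a b = ℚP.toℚᵘ-injective (begin
  ℚ.toℚᵘ (ℤ→ℚ (a ℤ.+ b))
    ≈⟨ toℚᵘ-ℤ→ℚ (a ℤ.+ b) ⟩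
  mkℚᵘ (a ℤ.+ b) 0
    ≈⟨ *≡* (cong (ℤ._* ℤ.+ 1) (sym (cong₂ ℤ._+_ (ℤP.*-identityʳ a) (ℤP.*-identityʳ b)))) ⟩
  mkℚᵘ a 0 ℚᵘ.+ mkℚᵘ b 0
    ≈⟨ ℚᵘP.+-cong (toℚᵘ-ℤ→ℚ a) (toℚᵘ-ℤ→ℚ b) ⟨
  ℚ.toℚᵘ (ℤ→ℚ a) ℚᵘ.+ ℚ.toℚᵘ (ℤ→ℚ b)
    ≈⟨ ℚP.toℚᵘ-homo-+ (ℤ→ℚ a) (ℤ→ℚ b) ⟨
  ℚ.toℚᵘ (ℤ→ℚ a + ℤ→ℚ b)
    ∎)
  where open ℚᵘP.≃-Reasoning

ℤ→ℚ-homo-* : ∀ a b → ℤ→ℚ (a ℤ.* b) ≡ ℤ→ℚ a * ℤ→ℚ b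
ℤ→ℚ-homo-* a b = ℚP.toℚᵘ-injective (begin
  ℚ.toℚᵘ (ℤ→ℚ (a ℤ.* b))
    ≈⟨ toℚᵘ-ℤ→ℚ (a ℤ.* b) ⟩
  mkℚᵘ a 0 ℚᵘ.* mkℚᵘ b 0
    ≈⟨ ℚᵘP.*-cong (toℚᵘ-ℤ→ℚ a) (toℚᵘ-ℤ→ℚ b) ⟨
  ℚ.toℚᵘ (ℤ→ℚ a) ℚᵘ.* ℚ.toℚᵘ (ℤ→ℚ b)
    ≈⟨ ℚP.toℚᵘ-homo-* (ℤ→ℚ a) (ℤ→ℚ b) ⟨
  ℚ.toℚᵘ (ℤ→ℚ a * ℤ→ℚ b)
    ∎)
  where open ℚᵘP.≃-Reasoning

ℤ→ℚ-homo‿- : ∀ a → ℤ→ℚ (ℤ.- a) ≡ - ℤ→ℚ a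
ℤ→ℚ-homo‿- a = ℚP.toℚᵘ-injective (begin
  ℚ.toℚᵘ (ℤ→ℚ (ℤ.- a))     ≈⟨ toℚᵘ-ℤ→ℚ (ℤ.- a) ⟩
  ℚᵘ.- mkℚᵘ a 0            ≈⟨ ℚᵘP.-‿cong (toℚᵘ-ℤ→ℚ a) ⟨
  ℚᵘ.- ℚ.toℚᵘ (ℤ→ℚ a)      ≈⟨ ℚP.toℚᵘ-homo‿- (ℤ→ℚ a) ⟨
  ℚ.toℚᵘ (- ℤ→ℚ a)         ∎)
  where open ℚᵘP.≃-Reasoning

ℤ→ℚ-homo-minus : ∀ a b → ℤ→ℚ (a ℤ.- b) ≡ ℤ→ℚ a - ℤ→ℚ b
ℤ→ℚ-homo-minus a b = trans (ℤ→ℚ-homo-+ a (ℤ.- b)) (cong (ℤ→ℚ a +_) (ℤ→ℚ-homo‿- b))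

ℤ→ℚ-homo-sum : ∀ {k} (f : Fin k → ℤ) → ℤ→ℚ (sumℤ f) ≡ sumℚ (λ j → ℤ→ℚ (f j))
ℤ→ℚ-homo-sum {zero}  f = refl
ℤ→ℚ-homo-sum {suc k} f =
  trans (ℤ→ℚ-homo-+ (f zero) _) (cong (ℤ→ℚ (f zero) +_) (ℤ→ℚ-homo-sum (λ j → f (suc j))))

ℤ→ℚ-mono-≤ : ∀ {a b} → a ℤ.≤ b → ℤ→ℚ a ≤ ℤ→ℚ b
ℤ→ℚ-mono-≤ {a} {b} a≤b rewrite ℤ→ℚ≡mkℚ a | ℤ→ℚ≡mkℚ b =
  *≤* (subst₂ ℤ._≤_ (sym (ℤP.*-identityʳ a)) (sym (ℤP.*-identityʳ b)) a≤b)

ℤ→ℚ-cancel-≤ : ∀ {a b} → ℤ→ℚ a ≤ ℤ→ℚ b → a ℤ.≤ b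
ℤ→ℚ-cancel-≤ {a} {b} ιa≤ιb rewrite ℤ→ℚ≡mkℚ a | ℤ→ℚ≡mkℚ b with ιa≤ιb
... | *≤* a≤b = subst₂ ℤ._≤_ (ℤP.*-identityʳ a) (ℤP.*-identityʳ b) a≤b

ℤ→ℚ-cancel-< : ∀ {a b} → ℤ→ℚ a < ℤ→ℚ b → a ℤ.< b
ℤ→ℚ-cancel-< {a} {b} ιa<ιb rewrite ℤ→ℚ≡mkℚ a | ℤ→ℚ≡mkℚ b with ιa<ιb
... | *<* a<b = subst₂ ℤ._<_ (ℤP.*-identityʳ a) (ℤP.*-identityʳ b) a<b

ℤ→ℚ-injective : ∀ {a b} → ℤ→ℚ a ≡ ℤ→ℚ b → a ≡ b
ℤ→ℚ-injective ιa≡ιb = ℤP.≤-antisym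
  (ℤ→ℚ-cancel-≤ (ℚP.≤-reflexive ιa≡ιb)) (ℤ→ℚ-cancel-≤ (ℚP.≤-reflexive (sym ιa≡ιb)))

ℤ→ℚ<1⇒≤0 : ∀ {z} → ℤ→ℚ z < 1ℚ → z ℤ.≤ ℤ.+ 0
ℤ→ℚ<1⇒≤0 ιz<1 = ℤP.i<j⇒i≤pred[j] (ℤ→ℚ-cancel-< {b = ℤ.+ 1} ιz<1)

-1<ℤ→ℚ⇒0≤ : ∀ {z} → - 1ℚ < ℤ→ℚ z → ℤ.+ 0 ℤ.≤ z
-1<ℤ→ℚ⇒0≤ -1<ιz = ℤP.i<j⇒suc[i]≤j (ℤ→ℚ-cancel-< {a = -[1+ 0 ]} -1<ιz)

1/[1+_] : ℕ → ℚ
1/[1+ k ] = ℚ.1/ mkℚ +[1+ k ] 0 (coprime-sym (1-coprimeTo (suc k)))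

ℤ→ℚ-*-1/[1+] : ∀ k → ℤ→ℚ +[1+ k ] * 1/[1+ k ] ≡ 1ℚ
ℤ→ℚ-*-1/[1+] k = trans (cong (_* 1/[1+ k ]) (ℤ→ℚ≡mkℚ +[1+ k ]))
  (ℚP.*-inverseʳ (mkℚ +[1+ k ] 0 (coprime-sym (1-coprimeTo (suc k)))))

1/[1+]-pos : ∀ k → 0ℚ < 1/[1+ k ]
1/[1+]-pos k = ℚP.positive⁻¹ 1/[1+ k ]

-[2+k]*z≤1⇒≤0 : ∀ k z → -[1+ suc k ] ℤ.* z ℤ.≤ ℤ.+ 1 → -[1+ suc k ] ℤ.* z ℤ.≤ ℤ.+ 0
-[2+k]*z≤1⇒≤0 k (ℤ.+ zero)  _ = ℤP.≤-reflexive (ℤP.*-zeroʳ -[1+ suc k ])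
-[2+k]*z≤1⇒≤0 k +[1+ m ]    _ = ℤ.-≤+
-[2+k]*z≤1⇒≤0 k -[1+ m ]    (ℤ.+≤+ (ℕ.s≤s m+[1+k]*[1+m]≤0))
  with ℕP.≤-trans (ℕP.m≤n+m (suc k ℕ.* suc m) m) m+[1+k]*[1+m]≤0
... | ()

z*[2+m]≢1 : ∀ z m → z ℤ.* +[1+ suc m ] ≢ ℤ.+ 1
z*[2+m]≢1 (ℤ.+ zero)  m ()
z*[2+m]≢1 +[1+ z ]    m ()
z*[2+m]≢1 -[1+ z ]    m ()

sumℚ≗sum : ∀ {k} (f : Fin k → ℚ) → sumℚ f ≡ sum f
sumℚ≗sum {zero}  f = refl
sumℚ≗sum {suc k} f = cong (f zero +_) (sumℚ≗sum (λ j → f (suc j)))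

sumℚ-cong : ∀ {k} {f g : Fin k → ℚ} → (∀ j → f j ≡ g j) → sumℚ f ≡ sumℚ g
sumℚ-cong {f = f} {g} f≗g
  rewrite sumℚ≗sum f | sumℚ≗sum g = sum-cong-≗ f≗g

sumℚ-distrib-+ : ∀ {k} (f g : Fin k → ℚ) → sumℚ (λ j → f j + g j) ≡ sumℚ f + sumℚ g
sumℚ-distrib-+ f g
  rewrite sumℚ≗sum f | sumℚ≗sum g | sumℚ≗sum (λ j → f j + g j) = ∑-distrib-+ f g

sumℚ-*ˡ : ∀ {k} (a : ℚ) (f : Fin k → ℚ) → sumℚ (λ j → a * f j) ≡ a * sumℚ f
sumℚ-*ˡ a f
  rewrite sumℚ≗sum f | sumℚ≗sum (λ j → a * f j) = sym (*-distribˡ-sum a f)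

sumℚ-*ʳ : ∀ {k} (a : ℚ) (f : Fin k → ℚ) → sumℚ (λ j → f j * a) ≡ sumℚ f * a
sumℚ-*ʳ a f
  rewrite sumℚ≗sum f | sumℚ≗sum (λ j → f j * a) = sym (*-distribʳ-sum a f)

sumℚ-comm : ∀ {k m} (f : Fin k → Fin m → ℚ) →
  sumℚ (λ i → sumℚ (λ j → f i j)) ≡ sumℚ (λ j → sumℚ (λ i → f i j))
sumℚ-comm {k} {m} f = begin
  sumℚ (λ i → sumℚ (λ j → f i j)) ≡⟨ sumℚ-cong (λ i → sumℚ≗sum (f i)) ⟩
  sumℚ (λ i → sum (λ j → f i j))  ≡⟨ sumℚ≗sum {k} _ ⟩
  sum (λ i → sum (λ j → f i j))   ≡⟨ ∑-comm f ⟩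
  sum (λ j → sum (λ i → f i j))   ≡⟨ sumℚ≗sum {m} _ ⟨
  sumℚ (λ j → sum (λ i → f i j))  ≡⟨ sumℚ-cong (λ j → sumℚ≗sum (λ i → f i j)) ⟨
  sumℚ (λ j → sumℚ (λ i → f i j)) ∎
  where open ≡-Reasoning

sumℚ-neg : ∀ {k} (f : Fin k → ℚ) → sumℚ (λ j → - f j) ≡ - sumℚ f
sumℚ-neg f = begin
  sumℚ (λ j → - f j)        ≡⟨ sumℚ-cong (λ j → -1* (f j)) ⟨
  sumℚ (λ j → - 1ℚ * f j)   ≡⟨ sumℚ-*ˡ (- 1ℚ) f ⟩
  - 1ℚ * sumℚ f             ≡⟨ -1* (sumℚ f) ⟩
  - sumℚ f                  ∎
  where
  open ≡-Reasoning
  -1* : ∀ a → - 1ℚ * a ≡ - a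
  -1* = solve-∀ ℚ-ring

sumℚ-minus : ∀ {k} (f g : Fin k → ℚ) → sumℚ (λ j → f j - g j) ≡ sumℚ f - sumℚ g
sumℚ-minus f g = trans (sumℚ-distrib-+ f (λ j → - g j)) (cong (sumℚ f +_) (sumℚ-neg g))

sumℚ-const : ∀ k (a : ℚ) → sumℚ {k} (λ _ → a) ≡ ℤ→ℚ (ℤ.+ k) * a
sumℚ-const zero    a = sym (ℚP.*-zeroˡ a)
sumℚ-const (suc k) a = begin
  a + sumℚ {k} (λ _ → a)               ≡⟨ cong (a +_) (sumℚ-const k a) ⟩
  a + ℤ→ℚ (ℤ.+ k) * a                  ≡⟨ factor a (ℤ→ℚ (ℤ.+ k)) ⟩
  (1ℚ + ℤ→ℚ (ℤ.+ k)) * a               ≡⟨ cong (_* a) (ℤ→ℚ-homo-+ (ℤ.+ 1) (ℤ.+ k)) ⟨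
  ℤ→ℚ (ℤ.+ suc k) * a                  ∎
  where
  open ≡-Reasoning
  factor : ∀ a b → a + b * a ≡ (1ℚ + b) * a
  factor = solve-∀ ℚ-ring

sumℚ-zero : ∀ k → sumℚ {k} (λ _ → 0ℚ) ≡ 0ℚ
sumℚ-zero k = trans (sumℚ≗sum {k} (λ _ → 0ℚ)) (sum-replicate-zero k)

sumℚ-mono-≤ : ∀ {k} {f g : Fin k → ℚ} → (∀ j → f j ≤ g j) → sumℚ f ≤ sumℚ g
sumℚ-mono-≤ {zero}  f≤g = ℚP.≤-refl
sumℚ-mono-≤ {suc k} f≤g = ℚP.+-mono-≤ (f≤g zero) (sumℚ-mono-≤ (λ j → f≤g (suc j)))

sumℚ-nonNeg : ∀ {k} {f : Fin k → ℚ} → (∀ j → 0ℚ ≤ f j) → 0ℚ ≤ sumℚ f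
sumℚ-nonNeg {k} {f} 0≤f = subst (_≤ sumℚ f) (sumℚ-zero k) (sumℚ-mono-≤ 0≤f)

nonNeg-sum≡0⇒≡0 : ∀ {k} (f : Fin k → ℚ) → (∀ j → 0ℚ ≤ f j) → sumℚ f ≡ 0ℚ →
  ∀ j → f j ≡ 0ℚ
nonNeg-sum≡0⇒≡0 f 0≤f Σf≡0 zero = ℚP.≤-antisym f₀≤0 (0≤f zero)
  where
  f₀≤0 : f zero ≤ 0ℚ
  f₀≤0 = subst₂ _≤_ (ℚP.+-identityʳ (f zero)) Σf≡0
    (ℚP.+-monoʳ-≤ (f zero) (sumℚ-nonNeg (λ j → 0≤f (suc j))))
nonNeg-sum≡0⇒≡0 f 0≤f Σf≡0 (suc j) =
  nonNeg-sum≡0⇒≡0 (λ j → f (suc j)) (λ j → 0≤f (suc j)) rest≡0 j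
  where
  rest≡0 : sumℚ (λ j → f (suc j)) ≡ 0ℚ
  rest≡0 = begin
    sumℚ (λ j → f (suc j))
      ≡⟨ ℚP.+-identityˡ _ ⟨
    0ℚ + sumℚ (λ j → f (suc j))
      ≡⟨ cong (_+ sumℚ (λ j → f (suc j))) (nonNeg-sum≡0⇒≡0 f 0≤f Σf≡0 zero) ⟨
    f zero + sumℚ (λ j → f (suc j))
      ≡⟨ Σf≡0 ⟩
    0ℚ
      ∎
    where open ≡-Reasoning

sumℚ-tight : ∀ {k} {f g : Fin k → ℚ} → (∀ j → f j ≤ g j) → sumℚ f ≡ sumℚ g →
  ∀ j → f j ≡ g j
sumℚ-tight {f = f} {g} f≤g Σf≡Σg j = sym (x∙y⁻¹≈ε⇒x≈y (g j) (f j)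
  (nonNeg-sum≡0⇒≡0 (λ j → g j - f j) (λ j → p≤q⇒0≤q-p (f≤g j)) Σ≡0 j))
  where
  Σ≡0 : sumℚ (λ j → g j - f j) ≡ 0ℚ
  Σ≡0 = begin
    sumℚ (λ j → g j - f j) ≡⟨ sumℚ-minus g f ⟩
    sumℚ g - sumℚ f        ≡⟨ cong (λ s → sumℚ g - s) Σf≡Σg ⟩
    sumℚ g - sumℚ g        ≡⟨ ℚP.+-inverseʳ (sumℚ g) ⟩
    0ℚ                     ∎
    where open ≡-Reasoning

sumℚ-weighted-≤ : ∀ {k} (c g : Fin k → ℚ) {M} → (∀ j → 0ℚ ≤ c j) → (∀ j → g j ≤ M) →
  sumℚ (λ j → c j * g j) ≤ sumℚ c * M
sumℚ-weighted-≤ c g {M} 0≤c g≤M = subst (_ ≤_) (sumℚ-*ʳ M c)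
  (sumℚ-mono-≤ (λ j → ℚP.*-monoˡ-≤-nonNeg (c j) {{ℚ.nonNegative (0≤c j)}} (g≤M j)))

sum-integers≤1⇒≤k-1 : ∀ {k} (a : Fin k → ℤ) → (∀ i → ℤ→ℚ (a i) ≤ 1ℚ) →
  ¬ (∀ i → ℤ→ℚ (a i) ≡ 1ℚ) → sumℚ (λ i → ℤ→ℚ (a i)) ≤ - 1ℚ + ℤ→ℚ (ℤ.+ k)
sum-integers≤1⇒≤k-1 {k} a a≤1 not-all-1 =
  subst₂ _≤_ (ℤ→ℚ-homo-sum a) (ℤ→ℚ-homo-+ -[1+ 0 ] (ℤ.+ k))
    (ℤ→ℚ-mono-≤ (ℤP.i<j⇒i≤pred[j] (ℤP.≤∧≢⇒< Σa≤k Σa≢k)))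
  where
  Σ1≡k : sumℚ {k} (λ _ → 1ℚ) ≡ ℤ→ℚ (ℤ.+ k)
  Σ1≡k = trans (sumℚ-const k 1ℚ) (ℚP.*-identityʳ _)
  Σa≤k : sumℤ a ℤ.≤ ℤ.+ k
  Σa≤k = ℤ→ℚ-cancel-≤ (subst₂ _≤_ (sym (ℤ→ℚ-homo-sum a)) Σ1≡k (sumℚ-mono-≤ a≤1))
  Σa≢k : sumℤ a ≢ ℤ.+ k
  Σa≢k Σa≡k = not-all-1 (sumℚ-tight a≤1
    (trans (sym (ℤ→ℚ-homo-sum a)) (trans (cong ℤ→ℚ Σa≡k) (sym Σ1≡k))))

unitVec-sym : ∀ {n} (i j : Fin n) → unitVec i j ≡ unitVec j i
unitVec-sym i j with i ≟ j | j ≟ i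
... | yes _   | yes _   = refl
... | no _    | no _    = refl
... | yes i≡j | no j≢i  = ⊥-elim (j≢i (sym i≡j))
... | no i≢j  | yes j≡i = ⊥-elim (i≢j (sym j≡i))

unitVec-nonNeg : ∀ {n} (i j : Fin n) → ℤ.+ 0 ℤ.≤ unitVec i j
unitVec-nonNeg i j with i ≟ j
... | yes _ = ℤ.+≤+ ℕ.z≤n
... | no _  = ℤ.+≤+ ℕ.z≤n

unitVec-suc : ∀ {n} (i j : Fin n) → unitVec (suc i) (suc j) ≡ unitVec i j
unitVec-suc i j with i ≟ j
... | yes _ = refl
... | no _  = refl

dot-comm : ∀ {n} (x y : Pointℚ n) → dot x y ≡ dot y x
dot-comm x y = sumℚ-cong (λ i → ℚP.*-comm (x i) (y i))

dot-unitVecˡ : ∀ {n} (i : Fin n) (y : Pointℚ n) → dot (embed (unitVec i)) y ≡ y i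
dot-unitVecˡ {suc n} zero y = begin
  1ℚ * y zero + sumℚ (λ l → 0ℚ * y (suc l))
    ≡⟨ cong₂ _+_ (ℚP.*-identityˡ (y zero)) (sumℚ-cong (λ l → ℚP.*-zeroˡ (y (suc l)))) ⟩
  y zero + sumℚ {n} (λ _ → 0ℚ)
    ≡⟨ cong (y zero +_) (sumℚ-zero n) ⟩
  y zero + 0ℚ
    ≡⟨ ℚP.+-identityʳ (y zero) ⟩
  y zero
    ∎
  where open ≡-Reasoning
dot-unitVecˡ (suc i) y = begin
  dot (embed (unitVec (suc i))) y
    ≡⟨ cong₂ _+_ (ℚP.*-zeroˡ (y zero))
                 (sumℚ-cong (λ l → cong (λ z → ℤ→ℚ z * y (suc l)) (unitVec-suc i l))) ⟩
  0ℚ + dot (embed (unitVec i)) (λ l → y (suc l))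
    ≡⟨ ℚP.+-identityˡ _ ⟩
  dot (embed (unitVec i)) (λ l → y (suc l))
    ≡⟨ dot-unitVecˡ i (λ l → y (suc l)) ⟩
  y (suc i)
    ∎
  where open ≡-Reasoning

sum-unitVec : ∀ {n} (i : Fin n) → sumℚ (embed (unitVec i)) ≡ 1ℚ
sum-unitVec i =
  trans (sumℚ-cong (λ l → sym (ℚP.*-identityʳ (ℤ→ℚ (unitVec i l))))) (dot-unitVecˡ i (λ _ → 1ℚ))

dot-translateˡ : ∀ {k n} (V : Fin k → Pointℤ n) (t : Pointℤ n) (j : Fin k) (y : Pointℚ n) →
  dot (embed (translate V t j)) y ≡ dot (embed (V j)) y - dot (embed t) y
dot-translateˡ V t j y = begin
  sumℚ (λ i → ℤ→ℚ (V j i ℤ.- t i) * y i)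
    ≡⟨ sumℚ-cong (λ i → cong (_* y i) (ℤ→ℚ-homo-minus (V j i) (t i))) ⟩
  sumℚ (λ i → (ℤ→ℚ (V j i) - ℤ→ℚ (t i)) * y i)
    ≡⟨ sumℚ-cong (λ i → *-distribʳ-minus (ℤ→ℚ (V j i)) (ℤ→ℚ (t i)) (y i)) ⟩
  sumℚ (λ i → ℤ→ℚ (V j i) * y i - ℤ→ℚ (t i) * y i)
    ≡⟨ sumℚ-minus (λ i → ℤ→ℚ (V j i) * y i) (λ i → ℤ→ℚ (t i) * y i) ⟩
  dot (embed (V j)) y - dot (embed t) y
    ∎
  where
  open ≡-Reasoning
  *-distribʳ-minus : ∀ a b c → (a - b) * c ≡ a * c - b * c
  *-distribʳ-minus = solve-∀ ℚ-ring

dot-sumˡ : ∀ {k n} (X : Fin k → Pointℚ n) (y : Pointℚ n) →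
  dot (λ l → sumℚ (λ i → X i l)) y ≡ sumℚ (λ i → dot (X i) y)
dot-sumˡ X y =
  trans (sumℚ-cong (λ l → sym (sumℚ-*ʳ (y l) (λ i → X i l)))) (sumℚ-comm (λ l i → X i l * y l))

dot-convexʳ : ∀ {k n} (c : Fin k → ℚ) (X : Fin k → Pointℚ n) (a y : Pointℚ n) →
  (∀ i → sumℚ (λ j → c j * X j i) ≡ y i) → dot a y ≡ sumℚ (λ j → c j * dot a (X j))
dot-convexʳ c X a y cX≡y = begin
  sumℚ (λ i → a i * y i)
    ≡⟨ sumℚ-cong (λ i → cong (a i *_) (cX≡y i)) ⟨
  sumℚ (λ i → a i * sumℚ (λ j → c j * X j i))
    ≡⟨ sumℚ-cong (λ i → sumℚ-*ˡ (a i) (λ j → c j * X j i)) ⟨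
  sumℚ (λ i → sumℚ (λ j → a i * (c j * X j i)))
    ≡⟨ sumℚ-comm (λ i j → a i * (c j * X j i)) ⟩
  sumℚ (λ j → sumℚ (λ i → a i * (c j * X j i)))
    ≡⟨ sumℚ-cong (λ j → sumℚ-cong (λ i → *-exchange (a i) (c j) (X j i))) ⟩
  sumℚ (λ j → sumℚ (λ i → c j * (a i * X j i)))
    ≡⟨ sumℚ-cong (λ j → sumℚ-*ˡ (c j) (λ i → a i * X j i)) ⟩
  sumℚ (λ j → c j * dot a (X j))
    ∎
  where
  open ≡-Reasoning
  *-exchange : ∀ a b c → a * (b * c) ≡ b * (a * c)
  *-exchange = solve-∀ ℚ-ring

vertex∈conv : ∀ {k n} (V : Fin k → Pointℤ n) (j : Fin k) → InConv V (embed (V j))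
vertex∈conv V j =
  embed (unitVec j) ,
  (λ l → ℤ→ℚ-mono-≤ (unitVec-nonNeg j l)) ,
  sum-unitVec j ,
  (λ i → dot-unitVecˡ j (λ l → ℤ→ℚ (V l i)))

∈conv⇒dot≤ : ∀ {k n} (U : Fin k → Pointℤ n) (a : Pointℚ n) {y : Pointℚ n} {M : ℚ} →
  InConv U y → (∀ j → dot a (embed (U j)) ≤ M) → dot a y ≤ M
∈conv⇒dot≤ U a {y} {M} (c , 0≤c , Σc≡1 , cU≡y) bound = begin
  dot a y
    ≡⟨ dot-convexʳ c (λ j → embed (U j)) a y cU≡y ⟩
  sumℚ (λ j → c j * dot a (embed (U j)))
    ≤⟨ sumℚ-weighted-≤ c (λ j → dot a (embed (U j))) 0≤c bound ⟩
  sumℚ c * M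
    ≡⟨ cong (_* M) Σc≡1 ⟩
  1ℚ * M
    ≡⟨ ℚP.*-identityˡ M ⟩
  M
    ∎
  where open ℚP.≤-Reasoning

polarDual-intro : ∀ {k n} (W : Fin k → Pointℤ n) (y : Pointℚ n) →
  (∀ j → dot (embed (W j)) y ≤ 1ℚ) → InPolarDual W y
polarDual-intro W y bound x x∈W = subst (_≤ 1ℚ) (dot-comm y x)
  (∈conv⇒dot≤ W y x∈W (λ j → subst (_≤ 1ℚ) (dot-comm (embed (W j)) y) (bound j)))

latticePolytope-dot≤ : ∀ {n} {S : Pointℚ n → Set} → IsLatticePolytope S →
  ∀ (a : Pointℚ n) {M : ℚ} → (∀ u → S (embed u) → dot a (embed u) ≤ M) →
  ∀ {y} → S y → dot a y ≤ M
latticePolytope-dot≤ (_ , U , S⇔convU) a bound {y} y∈S =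
  ∈conv⇒dot≤ U a (Equivalence.to (S⇔convU y) y∈S)
    (λ j → bound (U j) (Equivalence.from (S⇔convU (embed (U j))) (vertex∈conv U j)))

module Simplex (r : ℕ) {n : ℕ} (t : Pointℤ n) where

  W : Fin (suc n) → Pointℤ n
  W = translate (simplexVerts (λ _ → r)) t

  ρ N S : ℚ
  ρ = ℤ→ℚ (ℤ.+ r)
  N = ℤ→ℚ (ℤ.+ n)
  S = ℤ→ℚ (sumℤ t)

  T : Pointℚ n → ℚ
  T = dot (embed t)

  0≤ρ : 0ℚ ≤ ρ
  0≤ρ = ℤ→ℚ-mono-≤ (ℤ.+≤+ (ℕ.z≤n {r}))

  0≤1+ρN : 0ℚ ≤ 1ℚ + ρ * N
  0≤1+ρN = ℚP.+-mono-≤ (ℚP.<⇒≤ (ℚP.positive⁻¹ 1ℚ))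
    (*-nonNeg 0≤ρ (ℤ→ℚ-mono-≤ (ℤ.+≤+ (ℕ.z≤n {n}))))

  1≤N : .{{ℕ.NonZero n}} → 1ℚ ≤ N
  1≤N = ℤ→ℚ-mono-≤ (ℤ.+≤+ (ℕ.>-nonZero⁻¹ n))

  dot-W₀ : ∀ y → dot (embed (W zero)) y ≡ - ρ * sumℚ y - T y
  dot-W₀ y = trans (dot-translateˡ (simplexVerts (λ _ → r)) t zero y) (cong (_- T y)
    (trans (sumℚ-*ˡ (ℤ→ℚ (ℤ.- ℤ.+ r)) y) (cong (_* sumℚ y) (ℤ→ℚ-homo‿- (ℤ.+ r)))))

  dot-W-suc : ∀ i y → dot (embed (W (suc i))) y ≡ y i - T y
  dot-W-suc i y =
    trans (dot-translateˡ (simplexVerts (λ _ → r)) t (suc i) y) (cong (_- T y) (dot-unitVecˡ i y))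

  T-const : ∀ a → T (λ _ → a) ≡ S * a
  T-const a = trans (sumℚ-*ʳ a (embed t)) (cong (_* a) (sym (ℤ→ℚ-homo-sum t)))

  T-lattice : ∀ u → T (embed u) ≡ ℤ→ℚ (sumℤ (λ l → t l ℤ.* u l))
  T-lattice u = sym
    (trans (ℤ→ℚ-homo-sum (λ l → t l ℤ.* u l)) (sumℚ-cong (λ l → ℤ→ℚ-homo-* (t l) (u l))))

  W₀-coord : ∀ l → ℤ→ℚ (W zero l) ≡ - ρ - ℤ→ℚ (t l)
  W₀-coord l = trans (ℤ→ℚ-homo-minus (ℤ.- ℤ.+ r) (t l))
    (cong (_- ℤ→ℚ (t l)) (ℤ→ℚ-homo‿- (ℤ.+ r)))

  W-suc-coord : ∀ i l → ℤ→ℚ (W (suc i) l) ≡ ℤ→ℚ (unitVec l i) - ℤ→ℚ (t l)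
  W-suc-coord i l = trans (ℤ→ℚ-homo-minus (unitVec i l) (t l))
    (cong (λ z → ℤ→ℚ z - ℤ→ℚ (t l)) (unitVec-sym i l))

  conv-coord : ∀ (c : Fin (suc n) → ℚ) → sumℚ c ≡ 1ℚ → ∀ l →
    sumℚ (λ j → c j * ℤ→ℚ (W j l)) ≡ c (suc l) - ρ * c zero - ℤ→ℚ (t l)
  conv-coord c Σc≡1 l = begin
    c zero * ℤ→ℚ (W zero l) + sumℚ (λ i → c′ i * ℤ→ℚ (W (suc i) l))
      ≡⟨ cong₂ _+_ (cong (c zero *_) (W₀-coord l))
                   (sumℚ-cong (λ i → cong (c′ i *_) (W-suc-coord i l))) ⟩
    c zero * (- ρ - τ) + sumℚ (λ i → c′ i * (ℤ→ℚ (unitVec l i) - τ))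
      ≡⟨ cong (c zero * (- ρ - τ) +_) facets ⟩
    c zero * (- ρ - τ) + (c (suc l) - sumℚ c′ * τ)
      ≡⟨ regroup (c zero) (sumℚ c′) (c (suc l)) ρ τ ⟩
    c (suc l) - ρ * c zero - sumℚ c * τ
      ≡⟨ cong (λ s → c (suc l) - ρ * c zero - s * τ) Σc≡1 ⟩
    c (suc l) - ρ * c zero - 1ℚ * τ
      ≡⟨ cong (λ s → c (suc l) - ρ * c zero - s) (ℚP.*-identityˡ τ) ⟩
    c (suc l) - ρ * c zero - τ
      ∎
    where
    open ≡-Reasoning
    τ = ℤ→ℚ (t l)
    c′ : Fin n → ℚ
    c′ i = c (suc i)
    facets : sumℚ (λ i → c′ i * (ℤ→ℚ (unitVec l i) - τ)) ≡ c (suc l) - sumℚ c′ * τ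
    facets = begin
      sumℚ (λ i → c′ i * (ℤ→ℚ (unitVec l i) - τ))
        ≡⟨ sumℚ-cong (λ i → *-distribˡ-minus (c′ i) (ℤ→ℚ (unitVec l i)) τ) ⟩
      sumℚ (λ i → c′ i * ℤ→ℚ (unitVec l i) - c′ i * τ)
        ≡⟨ sumℚ-minus (λ i → c′ i * ℤ→ℚ (unitVec l i)) (λ i → c′ i * τ) ⟩
      dot c′ (embed (unitVec l)) - sumℚ (λ i → c′ i * τ)
        ≡⟨ cong₂ _-_ (trans (dot-comm c′ _) (dot-unitVecˡ l c′)) (sumℚ-*ʳ τ c′) ⟩
      c (suc l) - sumℚ c′ * τ
        ∎
      where
      *-distribˡ-minus : ∀ a b c → a * (b - c) ≡ a * b - a * c
      *-distribˡ-minus = solve-∀ ℚ-ring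
    regroup : ∀ c₀ A cₗ ρ τ → c₀ * (- ρ - τ) + (cₗ - A * τ) ≡ cₗ - ρ * c₀ - (c₀ + A) * τ
    regroup = solve-∀ ℚ-ring

  conv-coordSum : ∀ (c : Fin (suc n) → ℚ) → sumℚ c ≡ 1ℚ →
    sumℚ (λ l → sumℚ (λ j → c j * ℤ→ℚ (W j l))) ≡ 1ℚ - S - (1ℚ + ρ * N) * c zero
  conv-coordSum c Σc≡1 = begin
    sumℚ (λ l → sumℚ (λ j → c j * ℤ→ℚ (W j l)))
      ≡⟨ sumℚ-cong (conv-coord c Σc≡1) ⟩
    sumℚ (λ l → c (suc l) - ρ * c zero - ℤ→ℚ (t l))
      ≡⟨ sumℚ-minus (λ l → c (suc l) - ρ * c zero) (λ l → ℤ→ℚ (t l)) ⟩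
    sumℚ (λ l → c (suc l) - ρ * c zero) - sumℚ (λ l → ℤ→ℚ (t l))
      ≡⟨ cong₂ _-_ (sumℚ-minus (λ l → c (suc l)) (λ _ → ρ * c zero)) (sym (ℤ→ℚ-homo-sum t)) ⟩
    A - sumℚ {n} (λ _ → ρ * c zero) - S
      ≡⟨ cong (λ s → A - s - S) (sumℚ-const n (ρ * c zero)) ⟩
    A - N * (ρ * c zero) - S
      ≡⟨ regroup (c zero) A N ρ S ⟩
    (c zero + A) - S - (1ℚ + ρ * N) * c zero
      ≡⟨ cong (λ s → s - S - (1ℚ + ρ * N) * c zero) Σc≡1 ⟩
    1ℚ - S - (1ℚ + ρ * N) * c zero
      ∎
    where
    open ≡-Reasoning
    A = sumℚ (λ i → c (suc i))
    regroup : ∀ c₀ A N ρ S → A - N * (ρ * c₀) - S ≡ (c₀ + A) - S - (1ℚ + ρ * N) * c₀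
    regroup = solve-∀ ℚ-ring

  conv-coordSum-const : ∀ (c : Fin (suc n) → ℚ) → sumℚ c ≡ 1ℚ → ∀ a →
    (∀ l → sumℚ (λ j → c j * ℤ→ℚ (W j l)) ≡ a) → N * a ≡ 1ℚ - S - (1ℚ + ρ * N) * c zero
  conv-coordSum-const c Σc≡1 a cW≡a =
    trans (sym (sumℚ-const n a)) (trans (sumℚ-cong (λ l → sym (cW≡a l))) (conv-coordSum c Σc≡1))

  interior⇒sum≤0 : .{{ℕ.NonZero n}} → OriginInInterior W → sumℤ t ℤ.≤ ℤ.+ 0
  interior⇒sum≤0 interior with interior (λ _ → 1ℚ)
  ... | ε , 0<ε , c , 0≤c , Σc≡1 , cW≡ε = ℤ→ℚ<1⇒≤0 (0<q-p⇒p<q 0<1-S)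
    where
    1-S≡ : 1ℚ - S ≡ N * (ε * 1ℚ) + (1ℚ + ρ * N) * c zero
    1-S≡ = p≡q-r⇒q≡p+r {q = 1ℚ - S} (conv-coordSum-const c Σc≡1 (ε * 1ℚ) cW≡ε)
    0<1-S : 0ℚ < 1ℚ - S
    0<1-S = subst (0ℚ <_) (sym 1-S≡) (ℚP.+-mono-<-≤
      (*-pos (ℚP.<-≤-trans (ℚP.positive⁻¹ 1ℚ) 1≤N) (*-pos 0<ε (ℚP.positive⁻¹ 1ℚ)))
      (*-nonNeg 0≤1+ρN (0≤c zero)))

  interior⇒t≡0 : .{{ℕ.NonZero n}} → OriginInInterior W → sumℤ t ≡ ℤ.+ 0 →
    ∀ l → ℤ→ℚ (t l) ≡ 0ℚ
  interior⇒t≡0 interior Σt≡0 = nonNeg-sum≡0⇒≡0 (λ l → ℤ→ℚ (t l)) 0≤t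
    (trans (sym (ℤ→ℚ-homo-sum t)) (cong ℤ→ℚ Σt≡0))
    where
    -- c are barycentric coordinates of -ε(1,…,1); solving them for tₗ gives (1 + rn)(1 + tₗ) > 0
    0≤t : ∀ l → 0ℚ ≤ ℤ→ℚ (t l)
    0≤t l with interior (λ _ → - 1ℚ)
    ... | ε , 0<ε , c , 0≤c , Σc≡1 , cW≡-ε = ℤ→ℚ-mono-≤ (-1<ℤ→ℚ⇒0≤ {t l} -1<τ)
      where
      τ = ℤ→ℚ (t l)
      c₀ = c zero
      cₗ = c (suc l)
      τ≡ : τ ≡ cₗ - ρ * c₀ - ε * - 1ℚ
      τ≡ = p≡q-r⇒r≡q-p {q = cₗ - ρ * c₀} (trans (sym (cW≡-ε l)) (conv-coord c Σc≡1 l))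
      c₀≡ : (1ℚ + ρ * N) * c₀ ≡ 1ℚ - S - N * (ε * - 1ℚ)
      c₀≡ = p≡q-r⇒r≡q-p {q = 1ℚ - S} (conv-coordSum-const c Σc≡1 (ε * - 1ℚ) cW≡-ε)
      scaled : (1ℚ + ρ * N) * (1ℚ + τ) ≡ (1ℚ + ε) + ρ * (N - 1ℚ) + (1ℚ + ρ * N) * cₗ
      scaled = begin
        (1ℚ + ρ * N) * (1ℚ + τ)
          ≡⟨ cong (λ x → (1ℚ + ρ * N) * (1ℚ + x)) τ≡ ⟩
        (1ℚ + ρ * N) * (1ℚ + (cₗ - ρ * c₀ - ε * - 1ℚ))
          ≡⟨ expand ρ N cₗ c₀ ε ⟩
        (1ℚ + ρ * N) * (1ℚ + cₗ + ε) - ρ * ((1ℚ + ρ * N) * c₀)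
          ≡⟨ cong (λ x → (1ℚ + ρ * N) * (1ℚ + cₗ + ε) - ρ * x) c₀≡ ⟩
        (1ℚ + ρ * N) * (1ℚ + cₗ + ε) - ρ * (1ℚ - S - N * (ε * - 1ℚ))
          ≡⟨ cong (λ s → (1ℚ + ρ * N) * (1ℚ + cₗ + ε) - ρ * (1ℚ - s - N * (ε * - 1ℚ)))
                  (cong ℤ→ℚ Σt≡0) ⟩
        (1ℚ + ρ * N) * (1ℚ + cₗ + ε) - ρ * (1ℚ - 0ℚ - N * (ε * - 1ℚ))
          ≡⟨ collect ρ N cₗ ε ⟩
        (1ℚ + ε) + ρ * (N - 1ℚ) + (1ℚ + ρ * N) * cₗ
          ∎
        where
        open ≡-Reasoning
        expand : ∀ ρ N cₗ c₀ ε →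
          (1ℚ + ρ * N) * (1ℚ + (cₗ - ρ * c₀ - ε * - 1ℚ)) ≡
          (1ℚ + ρ * N) * (1ℚ + cₗ + ε) - ρ * ((1ℚ + ρ * N) * c₀)
        expand = solve-∀ ℚ-ring
        collect : ∀ ρ N cₗ ε →
          (1ℚ + ρ * N) * (1ℚ + cₗ + ε) - ρ * (1ℚ - 0ℚ - N * (ε * - 1ℚ)) ≡
          (1ℚ + ε) + ρ * (N - 1ℚ) + (1ℚ + ρ * N) * cₗ
        collect = solve-∀ ℚ-ring
      0<scaled : 0ℚ < (1ℚ + ρ * N) * (1ℚ + τ)
      0<scaled = subst (0ℚ <_) (sym scaled)
        (ℚP.+-mono-<-≤ (ℚP.+-mono-<-≤ (ℚP.+-mono-<-≤ (ℚP.positive⁻¹ 1ℚ) (ℚP.<⇒≤ 0<ε))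
                                      (*-nonNeg 0≤ρ (p≤q⇒0≤q-p 1≤N)))
                       (*-nonNeg 0≤1+ρN (0≤c (suc l))))
      -1<τ : - 1ℚ < τ
      -1<τ = 0<q-p⇒p<q (subst (0ℚ <_) (ℚP.+-comm 1ℚ τ)
        (ℚP.*-cancelˡ-<-nonNeg (1ℚ + ρ * N) {{ℚ.nonNegative 0≤1+ρN}}
          (subst (_< (1ℚ + ρ * N) * (1ℚ + τ)) (sym (ℚP.*-zeroʳ (1ℚ + ρ * N))) 0<scaled)))

module NegativeSum (r : ℕ) {n : ℕ} (t : Pointℤ n) {m : ℕ} (Σt≡ : sumℤ t ≡ -[1+ m ]) where
  open Simplex r t
  open ≡-Reasoning

  1-S≡2+m : 1ℚ - S ≡ ℤ→ℚ +[1+ suc m ]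
  1-S≡2+m = trans (cong (λ s → 1ℚ - ℤ→ℚ s) Σt≡) (sym (ℤ→ℚ-homo-minus (ℤ.+ 1) -[1+ m ]))

  facets-not-all-tight : (u : Pointℤ n) → ¬ (∀ i → dot (embed (W (suc i))) (embed u) ≡ 1ℚ)
  facets-not-all-tight u tight = z*[2+m]≢1 (ℤ.+ 1 ℤ.+ C) m (ℤ→ℚ-injective (begin
    ℤ→ℚ ((ℤ.+ 1 ℤ.+ C) ℤ.* +[1+ suc m ])
      ≡⟨ ℤ→ℚ-homo-* (ℤ.+ 1 ℤ.+ C) +[1+ suc m ] ⟩
    ℤ→ℚ (ℤ.+ 1 ℤ.+ C) * ℤ→ℚ +[1+ suc m ]
      ≡⟨ cong₂ _*_ (ℤ→ℚ-homo-+ (ℤ.+ 1) C) (sym 1-S≡2+m) ⟩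
    (1ℚ + ℤ→ℚ C) * (1ℚ - S)
      ≡⟨ distrib (ℤ→ℚ C) S ⟩
    1ℚ + ℤ→ℚ C - S * (1ℚ + ℤ→ℚ C)
      ≡⟨ cong (λ x → 1ℚ + ℤ→ℚ C - x) C≡S[1+C] ⟨
    1ℚ + ℤ→ℚ C - ℤ→ℚ C
      ≡⟨ cancel (ℤ→ℚ C) ⟩
    1ℚ
      ∎))
    where
    C = sumℤ (λ l → t l ℤ.* u l)
    u≡1+C : ∀ l → ℤ→ℚ (u l) ≡ 1ℚ + ℤ→ℚ C
    u≡1+C l = trans (p≡q-r⇒q≡p+r {q = ℤ→ℚ (u l)} (trans (sym (tight l)) (dot-W-suc l (embed u))))
                    (cong (1ℚ +_) (T-lattice u))
    C≡S[1+C] : ℤ→ℚ C ≡ S * (1ℚ + ℤ→ℚ C)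
    C≡S[1+C] = begin
      ℤ→ℚ C                  ≡⟨ T-lattice u ⟨
      T (embed u)            ≡⟨ sumℚ-cong (λ l → cong (ℤ→ℚ (t l) *_) (u≡1+C l)) ⟩
      T (λ _ → 1ℚ + ℤ→ℚ C)   ≡⟨ T-const (1ℚ + ℤ→ℚ C) ⟩
      S * (1ℚ + ℤ→ℚ C)       ∎
    distrib : ∀ x s → (1ℚ + x) * (1ℚ - s) ≡ 1ℚ + x - s * (1ℚ + x)
    distrib = solve-∀ ℚ-ring
    cancel : ∀ x → 1ℚ + x - x ≡ 1ℚ
    cancel = solve-∀ ℚ-ring

  -- the vertex of the dual polytope at which ⟨W (suc i), ·⟩ = 1 for every i
  oppositeVertex : Pointℚ n
  oppositeVertex _ = 1/[1+ suc m ]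

  [1-S]q≡1 : (1ℚ - S) * 1/[1+ suc m ] ≡ 1ℚ
  [1-S]q≡1 = trans (cong (_* 1/[1+ suc m ]) 1-S≡2+m) (ℤ→ℚ-*-1/[1+] (suc m))

  dot-W-suc-oppositeVertex : ∀ i → dot (embed (W (suc i))) oppositeVertex ≡ 1ℚ
  dot-W-suc-oppositeVertex i = begin
    dot (embed (W (suc i))) oppositeVertex  ≡⟨ dot-W-suc i oppositeVertex ⟩
    q - T oppositeVertex                    ≡⟨ cong (λ x → q - x) (T-const q) ⟩
    q - S * q                               ≡⟨ factor q S ⟩
    (1ℚ - S) * q                            ≡⟨ [1-S]q≡1 ⟩
    1ℚ                                      ∎
    where
    q = 1/[1+ suc m ]
    factor : ∀ q s → q - s * q ≡ (1ℚ - s) * q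
    factor = solve-∀ ℚ-ring

  dot-W₀-oppositeVertex≤1 : dot (embed (W zero)) oppositeVertex ≤ 1ℚ
  dot-W₀-oppositeVertex≤1 =
    0≤q-p⇒p≤q (subst (0ℚ ≤_) (sym slack) (*-nonNeg (ℚP.<⇒≤ (1/[1+]-pos (suc m))) 0≤1+ρN))
    where
    q = 1/[1+ suc m ]
    slack : 1ℚ - dot (embed (W zero)) oppositeVertex ≡ q * (1ℚ + ρ * N)
    slack = begin
      1ℚ - dot (embed (W zero)) oppositeVertex
        ≡⟨ cong₂ _-_ (sym [1-S]q≡1) (dot-W₀ oppositeVertex) ⟩
      (1ℚ - S) * q - (- ρ * sumℚ oppositeVertex - T oppositeVertex)
        ≡⟨ cong₂ (λ a b → (1ℚ - S) * q - (- ρ * a - b)) (sumℚ-const n q) (T-const q) ⟩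
      (1ℚ - S) * q - (- ρ * (N * q) - S * q)
        ≡⟨ collect S q ρ N ⟩
      q * (1ℚ + ρ * N)
        ∎
      where
      collect : ∀ s q ρ N → (1ℚ - s) * q - (- ρ * (N * q) - s * q) ≡ q * (1ℚ + ρ * N)
      collect = solve-∀ ℚ-ring

  oppositeVertex∈polarDual : InPolarDual W oppositeVertex
  oppositeVertex∈polarDual = polarDual-intro W oppositeVertex λ where
    zero    → dot-W₀-oppositeVertex≤1
    (suc i) → ℚP.≤-reflexive (dot-W-suc-oppositeVertex i)

  facetSum : Pointℚ n
  facetSum l = sumℚ (λ i → ℤ→ℚ (W (suc i) l))

  facetSum-lattice≤n-1 : ∀ u → InPolarDual W (embed u) → dot facetSum (embed u) ≤ - 1ℚ + N
  facetSum-lattice≤n-1 u u∈P* =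
    subst (_≤ - 1ℚ + N) (sym (trans (dot-sumˡ (λ i → embed (W (suc i))) (embed u)) (sumℚ-cong value)))
      (sum-integers≤1⇒≤k-1 (λ i → u i ℤ.- C)
        (λ i → subst (_≤ 1ℚ) (value i) (u∈P* (embed (W (suc i))) (vertex∈conv W (suc i))))
        (λ all-1 → facets-not-all-tight u (λ i → trans (value i) (all-1 i))))
    where
    C = sumℤ (λ l → t l ℤ.* u l)
    value : ∀ i → dot (embed (W (suc i))) (embed u) ≡ ℤ→ℚ (u i ℤ.- C)
    value i = trans (dot-W-suc i (embed u))
                    (trans (cong (λ x → ℤ→ℚ (u i) - x) (T-lattice u)) (sym (ℤ→ℚ-homo-minus (u i) C)))

  dot-facetSum-oppositeVertex : dot facetSum oppositeVertex ≡ N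
  dot-facetSum-oppositeVertex = begin
    dot facetSum oppositeVertex
      ≡⟨ dot-sumˡ (λ i → embed (W (suc i))) oppositeVertex ⟩
    sumℚ (λ i → dot (embed (W (suc i))) oppositeVertex)
      ≡⟨ sumℚ-cong dot-W-suc-oppositeVertex ⟩
    sumℚ {n} (λ _ → 1ℚ)
      ≡⟨ sumℚ-const n 1ℚ ⟩
    N * 1ℚ
      ≡⟨ ℚP.*-identityʳ N ⟩
    N
      ∎

  ¬latticeDual : ¬ IsLatticePolytope (InPolarDual W)
  ¬latticeDual latticeDual = ℚP.<-irrefl refl (ℚP.≤-<-trans N≤-1+N -1+N<N)
    where
    N≤-1+N : N ≤ - 1ℚ + N
    N≤-1+N = subst (_≤ - 1ℚ + N) dot-facetSum-oppositeVertex
      (latticePolytope-dot≤ latticeDual facetSum facetSum-lattice≤n-1 oppositeVertex∈polarDual)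
    -1+N<N : - 1ℚ + N < N
    -1+N<N = subst (- 1ℚ + N <_) (ℚP.+-identityˡ N) (ℚP.+-monoˡ-< N (ℚP.negative⁻¹ (- 1ℚ)))

module ZeroTranslation (k : ℕ) {n : ℕ} (t : Pointℤ n) (t≡0 : ∀ l → ℤ→ℚ (t l) ≡ 0ℚ) where
  open Simplex (suc (suc k)) t
  open ≡-Reasoning

  T≡0 : ∀ y → T y ≡ 0ℚ
  T≡0 y =
    trans (sumℚ-cong (λ l → trans (cong (_* y l) (t≡0 l)) (ℚP.*-zeroˡ (y l)))) (sumℚ-zero n)

  apexPoint : Fin n → Pointℚ n
  apexPoint i l = - 1/[1+ suc k ] * ℤ→ℚ (unitVec i l)

  dot-W₀-apexPoint : ∀ i → dot (embed (W zero)) (apexPoint i) ≡ 1ℚ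
  dot-W₀-apexPoint i = begin
    dot (embed (W zero)) (apexPoint i)
      ≡⟨ dot-W₀ (apexPoint i) ⟩
    - ρ * sumℚ (apexPoint i) - T (apexPoint i)
      ≡⟨ cong₂ (λ a b → - ρ * a - b) (sumℚ-*ˡ (- q) (embed (unitVec i))) (T≡0 (apexPoint i)) ⟩
    - ρ * (- q * sumℚ (embed (unitVec i))) - 0ℚ
      ≡⟨ cong (λ s → - ρ * (- q * s) - 0ℚ) (sum-unitVec i) ⟩
    - ρ * (- q * 1ℚ) - 0ℚ
      ≡⟨ simplify ρ q ⟩
    ρ * q
      ≡⟨ ℤ→ℚ-*-1/[1+] (suc k) ⟩
    1ℚ
      ∎
    where
    q = 1/[1+ suc k ]
    simplify : ∀ ρ q → - ρ * (- q * 1ℚ) - 0ℚ ≡ ρ * q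
    simplify = solve-∀ ℚ-ring

  apexPoint≤0 : ∀ i l → apexPoint i l ≤ 0ℚ
  apexPoint≤0 i l = subst (apexPoint i l ≤_) (ℚP.*-zeroˡ (ℤ→ℚ (unitVec i l)))
    (ℚP.*-monoʳ-≤-nonNeg (ℤ→ℚ (unitVec i l))
      {{ℚ.nonNegative (ℤ→ℚ-mono-≤ (unitVec-nonNeg i l))}}
      (ℚP.neg-antimono-≤ (ℚP.<⇒≤ (1/[1+]-pos (suc k)))))

  dot-W-suc-apexPoint : ∀ i l → dot (embed (W (suc l))) (apexPoint i) ≡ apexPoint i l
  dot-W-suc-apexPoint i l = trans (dot-W-suc l (apexPoint i))
    (trans (cong (λ x → apexPoint i l - x) (T≡0 (apexPoint i))) (ℚP.+-identityʳ (apexPoint i l)))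

  apexPoint∈polarDual : ∀ i → InPolarDual W (apexPoint i)
  apexPoint∈polarDual i = polarDual-intro W (apexPoint i) λ where
    zero    → ℚP.≤-reflexive (dot-W₀-apexPoint i)
    (suc l) → subst (_≤ 1ℚ) (sym (dot-W-suc-apexPoint i l))
                (ℚP.≤-trans (apexPoint≤0 i l) (ℚP.<⇒≤ (ℚP.positive⁻¹ 1ℚ)))

  -- at a lattice point u, ⟨W zero, u⟩ = -r Σ u is a multiple of r ≥ 2
  dot-W₀-lattice≤0 : ∀ u → InPolarDual W (embed u) → dot (embed (W zero)) (embed u) ≤ 0ℚ
  dot-W₀-lattice≤0 u u∈P* =
    subst (_≤ 0ℚ) (sym value) (ℤ→ℚ-mono-≤ (-[2+k]*z≤1⇒≤0 k (sumℤ u) (ℤ→ℚ-cancel-≤ value≤1)))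
    where
    value : dot (embed (W zero)) (embed u) ≡ ℤ→ℚ (-[1+ suc k ] ℤ.* sumℤ u)
    value = begin
      dot (embed (W zero)) (embed u)
        ≡⟨ dot-W₀ (embed u) ⟩
      - ρ * sumℚ (embed u) - T (embed u)
        ≡⟨ cong₂ (λ a b → - ρ * a - b) (sym (ℤ→ℚ-homo-sum u)) (T≡0 (embed u)) ⟩
      - ρ * ℤ→ℚ (sumℤ u) - 0ℚ
        ≡⟨ ℚP.+-identityʳ (- ρ * ℤ→ℚ (sumℤ u)) ⟩
      - ρ * ℤ→ℚ (sumℤ u)
        ≡⟨ ℤ→ℚ-homo-* -[1+ suc k ] (sumℤ u) ⟨
      ℤ→ℚ (-[1+ suc k ] ℤ.* sumℤ u)
        ∎
    value≤1 : ℤ→ℚ (-[1+ suc k ] ℤ.* sumℤ u) ≤ 1ℚ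
    value≤1 = subst (_≤ 1ℚ) value (u∈P* (embed (W zero)) (vertex∈conv W zero))

  ¬latticeDual : Fin n → ¬ IsLatticePolytope (InPolarDual W)
  ¬latticeDual i latticeDual = ℚP.<-irrefl refl (ℚP.<-≤-trans (ℚP.positive⁻¹ 1ℚ) 1≤0)
    where
    1≤0 : 1ℚ ≤ 0ℚ
    1≤0 = subst (_≤ 0ℚ) (dot-W₀-apexPoint i)
      (latticePolytope-dot≤ latticeDual (embed (W zero)) dot-W₀-lattice≤0 (apexPoint∈polarDual i))

r≥2⇒¬reflexive : ∀ k n → ¬ IsReflexive (simplexVerts {suc n} (λ _ → suc (suc k)))
r≥2⇒¬reflexive k n (t , interior , latticeDual) = by-sign (sumℤ t) refl (interior⇒sum≤0 interior)
  where
  open Simplex (suc (suc k)) t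
  by-sign : ∀ s → sumℤ t ≡ s → s ℤ.≤ ℤ.+ 0 → ⊥
  by-sign +[1+ m ]   _    (ℤ.+≤+ ())
  by-sign (ℤ.+ zero) Σt≡0 _ =
    ZeroTranslation.¬latticeDual k t (interior⇒t≡0 interior Σt≡0) zero latticeDual
  by-sign -[1+ m ]   Σt<0 _ = NegativeSum.¬latticeDual (suc (suc k)) t Σt<0 latticeDual

proposition3p7 : (r₁ x₁ : ℕ) → 1 ℕ.≤ r₁ → 1 ℕ.≤ x₁ →
    IsReflexive (simplexVerts {x₁} (λ _ → r₁)) →
    IsIDP (simplexVerts {x₁} (λ _ → r₁)) →
    r₁ ≡ 1
proposition3p7 zero          _       ()   _  _         _
proposition3p7 (suc zero)    _       _    _  _         _ = refl
proposition3p7 (suc (suc k)) zero    _    () _         _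
proposition3p7 (suc (suc k)) (suc n) _    _  reflexive _ = ⊥-elim (r≥2⇒¬reflexive k n reflexive)
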